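{- Let $U$ be a based scheme on $Y$ and $S$ a based scheme on $Z$, let $\tilde T\subseteq S$ be a closed subset, and let $i:U\to S$ be a based morphism of schemes such that $i\pi:U\to S/\!\!/\tilde T$ is an isomorphism ($\pi$ the natural morphism). Assume $|t(ui)|=1$ for every $u\in U$ and $t\in\tilde T$. Suppose $p,q,r\in U$ with $r\in pq$, and $z_1,z_3\in Z$ with $z_3\in z_1(ri)$. Let $y_1,y_3\in Y$ be the elements with $z_1\tilde T=(y_1i)\tilde T$ and $z_3\tilde T=(y_3i)\tilde T$. If $y_2\in y_1p\cap y_3q^*$, then there exists $z_2\in z_1(pi)\cap z_3(qi)^*$ such that $z_2\tilde T=(y_2i)\tilde T$.
   Context: All schemes are association schemes on finite sets. For a point $w$ and relation $s$, $ws=\{w':(w,w')\in s\}$; $s^*$ is the transpose. Complex product $pq=\{r:a_{pqr}>0\}$; closed: $\tilde T^*\tilde T\subseteq\tilde T$. For closed $\tilde T$: $z\tilde T=\bigcup_{t\in\tilde T}zt$; $s^{\tilde T}=\{(z_1\tilde T,z_2\tilde T):(z_1',z_2')\in s$ for some $z_i'\in z_i\tilde T\}$; $S/\!\!/\tilde T=\{s^{\tilde T}\}$. A morphism $i$ from $U$ on $Y$ to $S$ on $Z$ is a map $y\mapsto yi$ sending pairs in a common element of $U$ to pairs in a common element of $S$; $ui$ is the element of $S$ containing the images of pairs of $u$. Isomorphisms are bijective on points and relations (so the elements $y_1,y_3$ above exist and are unique); based morphisms preserve basepoints. -}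

module Defs where

open import Data.Nat using (ℕ; _<_)
open import Data.Fin using (Fin)
open import Data.Fin.Properties using (_≟_)
open import Data.List using (length; filter; allFin)
open import Data.Product using (Σ; ∃; _×_; _,_; proj₁; proj₂)
open import Relation.Nullary.Decidable using (_×-dec_)
open import Relation.Unary using (Pred; Decidable)
open import Relation.Binary.PropositionalEquality using (_≡_)
open import Function.Bundles using (_⇔_)
open import Level using (0ℓ)

count : ∀ {n} {P : Pred (Fin n) 0ℓ} → Decidable P → ℕ
count {n} P? = length (filter P? (allFin n))

-- An association scheme on the finite point set Fin n with relation set Fin m.
-- rel x y is the (unique) relation containing the pair (x , y); so the relations
-- partition Fin n × Fin n.
record Scheme (n m : ℕ) : Set where
  field
    rel      : Fin n → Fin n → Fin m
    witness  : (s : Fin m) → Σ (Fin n × Fin n) (λ xy → rel (proj₁ xy) (proj₂ xy) ≡ s)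
    one      : Fin m
    one-spec : ∀ x y → (rel x y ≡ one) ⇔ (x ≡ y)
    _*       : Fin m → Fin m
    transpose : ∀ x y → rel y x ≡ (rel x y) *
    regular  : ∀ p q r x z x' z' → rel x z ≡ r → rel x' z' ≡ r →
               count (λ y → (rel x y ≟ p) ×-dec (rel y z ≟ q))
                 ≡ count (λ y → (rel x' y ≟ p) ×-dec (rel y z' ≟ q))

  a : Fin m → Fin m → Fin m → ℕ
  a p q r = let x = proj₁ (proj₁ (witness r)) ; z = proj₂ (proj₁ (witness r))
            in count (λ y → (rel x y ≟ p) ×-dec (rel y z ≟ q))

  _∈_·_ : Fin m → Fin m → Fin m → Set
  r ∈ p · q = 0 < a p q r

  ∣_·_∣ : Fin m → Fin m → ℕ
  ∣ p · q ∣ = count (λ r → 0 Data.Nat.<? a p q r)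
    where import Data.Nat

  _∈_⟨_⟩ : Fin n → Fin n → Fin m → Set
  w' ∈ w ⟨ s ⟩ = rel w w' ≡ s

  Closed : Pred (Fin m) 0ℓ → Set
  Closed T = ∀ s t r → T s → T t → r ∈ (s *) · t → T r

  InCoset : Pred (Fin m) 0ℓ → Fin n → Fin n → Set
  InCoset T z w' = ∃ λ t → T t × (w' ∈ z ⟨ t ⟩)

  CosetEq : Pred (Fin m) 0ℓ → Fin n → Fin n → Set
  CosetEq T z₁ z₂ = ∀ w → InCoset T z₁ w ⇔ InCoset T z₂ w

  -- (z₁T , z₂T) ∈ s^T
  InQuot : Pred (Fin m) 0ℓ → Fin m → Fin n → Fin n → Set
  InQuot T s z₁ z₂ = ∃ λ z₁' → ∃ λ z₂' → InCoset T z₁ z₁' × InCoset T z₂ z₂' × rel z₁' z₂' ≡ s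

  QuotEq : Pred (Fin m) 0ℓ → Fin m → Fin m → Set
  QuotEq T s s' = ∀ z₁ z₂ → InQuot T s z₁ z₂ ⇔ InQuot T s' z₁ z₂

record BasedScheme (n m : ℕ) : Set where
  field
    scheme : Scheme n m
    base   : Fin n
  open Scheme scheme public

module _ {nY mU nZ mS : ℕ} (U : BasedScheme nY mU) (S : BasedScheme nZ mS) where
  private
    module U = BasedScheme U
    module S = BasedScheme S

  IsMorphism : (Fin nY → Fin nZ) → Set
  IsMorphism f = ∀ y₁ y₂ y₃ y₄ → U.rel y₁ y₂ ≡ U.rel y₃ y₄ →
                 S.rel (f y₁) (f y₂) ≡ S.rel (f y₃) (f y₄)

  IsBasedMorphism : (Fin nY → Fin nZ) → Set
  IsBasedMorphism f = IsMorphism f × f U.base ≡ S.base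

  -- u i : the element of S containing the images of the pairs of u
  relMap : (Fin nY → Fin nZ) → Fin mU → Fin mS
  relMap f u = S.rel (f (proj₁ (proj₁ (U.witness u)))) (f (proj₂ (proj₁ (U.witness u))))

  -- i π : U → S//T is an isomorphism, where π : S → S//T is the natural morphism
  -- (z ↦ zT, s ↦ s^T); so y(iπ) = (yi)T and u(iπ) = (ui)^T.
  -- Isomorphism = bijective on points and on relations.
  IsoToQuotient : Pred (Fin mS) 0ℓ → (Fin nY → Fin nZ) → Set
  IsoToQuotient T f =
      (∀ y y' → S.CosetEq T (f y) (f y') → y ≡ y')
    × (∀ z → ∃ λ y → S.CosetEq T z (f y))
    × (∀ u u' → S.QuotEq T (relMap f u) (relMap f u') → u ≡ u')
    × (∀ s → ∃ λ u → S.QuotEq T s (relMap f u))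

-- Write s₁ = pi, s₃ = qi, and let iπ⁻¹ be the inverse of iπ on points, so zT = (iπ⁻¹ z)i T.
-- Call w a midpoint of (e₁ , e₃) if w ∈ e₁s₁ ∩ e₃s₃*. Since (z₁ , z₃) and (x₁ , x₃) = (y₁i , y₃i)
-- both lie in ri, they have equally many midpoints; split both counts into iπ⁻¹-fibres. Thinness
-- (|t(ui)| = 1) shows that the fibre through a midpoint w₀ is {w : w₀w admissible} for a fixed set
-- of admissible relations, so all nonempty fibres have the same size. A midpoint of (z₁ , z₃) over
-- y satisfies y₁ p y q in U, so yi is a midpoint of (x₁ , x₃) over y: every (z₁ , z₃)-fibre is at
-- most the (x₁ , x₃)-fibre over the same point. Equal totals force equality everywhere, and the
-- fibre over y₂ is nonempty for (x₁ , x₃) because it contains y₂i.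
-- If T is empty, U is trivial and regularity of S alone provides z₂.
module Submission where

open import Data.Bool using (true; false; _∧_; if_then_else_)
open import Data.Empty using (⊥-elim)
open import Data.Fin using (Fin; zero; suc)
open import Data.Fin.Properties using (_≟_; any?)
open import Data.List using ([]; _∷_; length; filter; allFin)
open import Data.List.Properties using (filter-some; filter-none; filter-≐)
open import Data.List.Relation.Unary.All using (universal)
open import Data.List.Relation.Unary.Any using (here)
open import Data.List.Membership.Propositional as List using (lose)
open import Data.List.Membership.Propositional.Properties using (∈-filter⁺; ∈-filter⁻; ∈-allFin)
open import Data.Nat using (ℕ; zero; suc; _+_; _≤_; _<_; _<?_; z≤n; s≤s)
open import Data.Nat.Properties
  using (+-0-commutativeMonoid; +-mono-≤; +-monoʳ-≤; +-cancelʳ-≤; +-cancelˡ-≡;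
         ≤-antisym; ≤-trans; ≤-reflexive)
open import Algebra.Properties.CommutativeMonoid.Sum +-0-commutativeMonoid
  using (sum; sum-cong-≗; sum-replicate-zero; ∑-distrib-+)
open import Data.Product using (∃; _×_; _,_; proj₁; proj₂)
open import Function using (_∘_)
open import Function.Bundles using (Equivalence; mk⇔)
open import Level using (0ℓ)
open import Relation.Nullary using (¬_; Dec; yes; no; does; _×-dec_)
open import Relation.Nullary.Decidable using (map′; decidable-stable; ¬¬-excluded-middle)
open import Relation.Unary using (Pred; Decidable; _≐_)
open import Relation.Binary.PropositionalEquality
open ≡-Reasoning

open import Defs

module _ {A : Set} {P : Pred A 0ℓ} (P? : Decidable P) where

  length-filter-∷ : ∀ x xs →
    length (filter P? (x ∷ xs)) ≡ (if does (P? x) then 1 else 0) + length (filter P? xs)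
  length-filter-∷ x xs with does (P? x)
  ... | true  = refl
  ... | false = refl

  length-filter>0⇒∃ : ∀ xs → 0 < length (filter P? xs) → ∃ P
  length-filter>0⇒∃ xs _ with filter P? xs in eq
  ... | y ∷ _ = y , proj₂ (∈-filter⁻ P? {xs = xs} (subst (y List.∈_) (sym eq) (here refl)))

  length-filter≡1⇒unique : ∀ {xs x y} → length (filter P? xs) ≡ 1 →
    x List.∈ xs → y List.∈ xs → P x → P y → x ≡ y
  length-filter≡1⇒unique {xs} len≡1 x∈xs y∈xs px py
    with filter P? xs | ∈-filter⁺ P? x∈xs px | ∈-filter⁺ P? y∈xs py
  ... | _ ∷ [] | here refl | here refl = refl

∑-if-≟ : ∀ {k} b (c : Fin k) →
  sum (λ j → if b ∧ does (c ≟ j) then 1 else 0) ≡ (if b then 1 else 0)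
∑-if-≟ {k}     false c       = sum-replicate-zero k
∑-if-≟ {suc k} true  zero    = cong suc (sum-replicate-zero k)
∑-if-≟ {suc k} true  (suc c) = ∑-if-≟ true c

length-filter-fibres : ∀ {A : Set} {P : Pred A 0ℓ} (P? : Decidable P) {k} (g : A → Fin k) xs →
  length (filter P? xs) ≡ sum (λ j → length (filter (λ x → P? x ×-dec (g x ≟ j)) xs))
length-filter-fibres P? {k} g [] = sym (sum-replicate-zero k)
length-filter-fibres P? g (x ∷ xs) = begin
  length (filter P? (x ∷ xs))
    ≡⟨ length-filter-∷ P? x xs ⟩
  (if does (P? x) then 1 else 0) + length (filter P? xs)
    ≡⟨ cong₂ _+_ (∑-if-≟ (does (P? x)) (g x)) (sym (length-filter-fibres P? g xs)) ⟨
  sum (λ j → if does (Q? j x) then 1 else 0) + sum (λ j → length (filter (Q? j) xs))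
    ≡⟨ ∑-distrib-+ (λ j → if does (Q? j x) then 1 else 0) (λ j → length (filter (Q? j) xs)) ⟨
  sum (λ j → (if does (Q? j x) then 1 else 0) + length (filter (Q? j) xs))
    ≡⟨ sum-cong-≗ (λ j → length-filter-∷ (Q? j) x xs) ⟨
  sum (λ j → length (filter (Q? j) (x ∷ xs))) ∎
  where Q? = λ j x → P? x ×-dec (g x ≟ j)

∑-mono-≤ : ∀ {k} {f g : Fin k → ℕ} → (∀ j → f j ≤ g j) → sum f ≤ sum g
∑-mono-≤ {zero}  f≤g = z≤n
∑-mono-≤ {suc k} f≤g = +-mono-≤ (f≤g zero) (∑-mono-≤ (f≤g ∘ suc))

∑-≤-≡⇒≗ : ∀ {k} {f g : Fin k → ℕ} → (∀ j → f j ≤ g j) → sum f ≡ sum g → ∀ j → f j ≡ g j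
∑-≤-≡⇒≗ {suc k} {f} {g} f≤g ∑f≡∑g = λ where
    zero    → head≡
    (suc j) → ∑-≤-≡⇒≗ (f≤g ∘ suc) tail≡ j
  where
  head≡ : f zero ≡ g zero
  head≡ = ≤-antisym (f≤g zero) (+-cancelʳ-≤ _ (g zero) (f zero)
    (≤-trans (≤-reflexive (sym ∑f≡∑g)) (+-monoʳ-≤ (f zero) (∑-mono-≤ (f≤g ∘ suc)))))
  tail≡ : sum (f ∘ suc) ≡ sum (g ∘ suc)
  tail≡ = +-cancelˡ-≡ (f zero) _ _ (trans ∑f≡∑g (cong (_+ _) (sym head≡)))

count-≐ : ∀ {k} {P Q : Pred (Fin k) 0ℓ} (P? : Decidable P) (Q? : Decidable Q) →
  P ≐ Q → count P? ≡ count Q?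
count-≐ P? Q? P≐Q = cong length (filter-≐ P? Q? P≐Q (allFin _))

count-const-× : ∀ {k} {A : Set} {Q : Pred (Fin k) 0ℓ} (A? : Dec A) (Q? : Decidable Q) →
  count (λ w → A? ×-dec Q? w) ≡ (if does A? then count Q? else 0)
count-const-× (yes α) Q? = count-≐ (λ w → yes α ×-dec Q? w) Q? (proj₂ , (α ,_))
count-const-× (no ¬α) Q? =
  cong length (filter-none (λ w → no ¬α ×-dec Q? w) (universal (λ _ → ¬α ∘ proj₁) (allFin _)))

module SchemeProperties {n m : ℕ} (S : Scheme n m) where
  open Scheme S

  rel-refl : ∀ x → rel x x ≡ one
  rel-refl x = Equivalence.from (one-spec x x) refl

  *-involutive : ∀ s → s * * ≡ s
  *-involutive s with witness s
  ... | (x , y) , refl = trans (cong _* (sym (transpose x y))) (sym (transpose y x))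

  rel-transpose : ∀ {x y s} → rel x y ≡ s → rel y x ≡ s *
  rel-transpose {x} {y} e = trans (transpose x y) (cong _* e)

  Midpoint : Fin m → Fin m → Fin n → Fin n → Pred (Fin n) 0ℓ
  Midpoint p q x z y = rel x y ≡ p × rel y z ≡ q

  midpoint? : ∀ p q x z → Decidable (Midpoint p q x z)
  midpoint? p q x z y = (rel x y ≟ p) ×-dec (rel y z ≟ q)

  #midpoints-regular : ∀ {x z x' z'} p q → rel x z ≡ rel x' z' →
    count (midpoint? p q x z) ≡ count (midpoint? p q x' z')
  #midpoints-regular p q e = regular p q _ _ _ _ _ refl (sym e)

  a≡#midpoints : ∀ {x z} p q {r} → rel x z ≡ r → a p q r ≡ count (midpoint? p q x z)
  a≡#midpoints p q {r} refl = #midpoints-regular p q (proj₂ (witness r))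

  midpoint⇒∈· : ∀ {p q x y z} → Midpoint p q x z y → rel x z ∈ p · q
  midpoint⇒∈· {p} {q} {x} {y} {z} xyz = subst (0 <_) (sym (a≡#midpoints p q refl))
    (filter-some (midpoint? p q x z) (lose (∈-allFin y) xyz))

  ∈·⇒midpoint : ∀ {p q r x z} → r ∈ p · q → rel x z ≡ r → ∃ (Midpoint p q x z)
  ∈·⇒midpoint {p} {q} r∈pq e =
    length-filter>0⇒∃ _ (allFin n) (subst (0 <_) (a≡#midpoints p q e) r∈pq)

  midpoint-transfer : ∀ {x y z x' z'} → rel x z ≡ rel x' z' →
    ∃ (Midpoint (rel x y) (rel y z) x' z')
  midpoint-transfer e = ∈·⇒midpoint (midpoint⇒∈· (refl , refl)) (sym e)

  ∈·-unique : ∀ {t s r r'} → ∣ t · s ∣ ≡ 1 → r ∈ t · s → r' ∈ t · s → r ≡ r'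
  ∈·-unique {t} {s} {r} {r'} ∣ts∣≡1 =
    length-filter≡1⇒unique (λ r → 0 <? a t s r) ∣ts∣≡1 (∈-allFin r) (∈-allFin r')

  valency-invariant : ∀ x x' t → count (λ w → rel x w ≟ t) ≡ count (λ w → rel x' w ≟ t)
  valency-invariant x x' t = begin
    count (λ w → rel x w ≟ t)         ≡⟨ out-and-back x ⟩
    count (midpoint? t (t *) x x)     ≡⟨ #midpoints-regular t (t *) (trans (rel-refl x) (sym (rel-refl x'))) ⟩
    count (midpoint? t (t *) x' x')   ≡⟨ out-and-back x' ⟨
    count (λ w → rel x' w ≟ t)        ∎
    where
    out-and-back : ∀ x → count (λ w → rel x w ≟ t) ≡ count (midpoint? t (t *) x x)
    out-and-back x = count-≐ _ (midpoint? t (t *) x x) ((λ e → e , rel-transpose e) , proj₁)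

  count-rel-invariant : {R : Pred (Fin m) 0ℓ} (R? : Decidable R) → ∀ x x' →
    count (R? ∘ rel x) ≡ count (R? ∘ rel x')
  count-rel-invariant {R} R? x x' = begin
    count (R? ∘ rel x)
      ≡⟨ length-filter-fibres (R? ∘ rel x) (rel x) (allFin n) ⟩
    sum (λ t → count (λ w → R? (rel x w) ×-dec (rel x w ≟ t)))
      ≡⟨ sum-cong-≗ (fibre x) ⟩
    sum (λ t → if does (R? t) then count (λ w → rel x w ≟ t) else 0)
      ≡⟨ sum-cong-≗ (λ t → cong (if does (R? t) then_else 0) (valency-invariant x x' t)) ⟩
    sum (λ t → if does (R? t) then count (λ w → rel x' w ≟ t) else 0)
      ≡⟨ sum-cong-≗ (fibre x') ⟨
    sum (λ t → count (λ w → R? (rel x' w) ×-dec (rel x' w ≟ t)))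
      ≡⟨ length-filter-fibres (R? ∘ rel x') (rel x') (allFin n) ⟨
    count (R? ∘ rel x') ∎
    where
    fibre : ∀ x t → count (λ w → R? (rel x w) ×-dec (rel x w ≟ t))
                  ≡ (if does (R? t) then count (λ w → rel x w ≟ t) else 0)
    fibre x t = trans
      (count-≐ _ (λ w → R? t ×-dec (rel x w ≟ t))
        ((λ (r , e) → subst R e r , e) , (λ (r , e) → subst R (sym e) r , e)))
      (count-const-× (R? t) (λ w → rel x w ≟ t))

module MorphismProperties {nY mU nZ mS : ℕ} (U : BasedScheme nY mU) (S : BasedScheme nZ mS)
  {i : Fin nY → Fin nZ} (i-mor : IsMorphism U S i) where
  private
    module U = BasedScheme U
    module S = BasedScheme S

  relMap-rel : ∀ y y' → relMap U S i (U.rel y y') ≡ S.rel (i y) (i y')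
  relMap-rel y y' = i-mor _ _ y y' (proj₂ (U.witness (U.rel y y')))

  relMap-midpoint : ∀ {p q y₁ y₂ y₃} → SchemeProperties.Midpoint U.scheme p q y₁ y₃ y₂ →
    SchemeProperties.Midpoint S.scheme (relMap U S i p) (relMap U S i q) (i y₁) (i y₃) (i y₂)
  relMap-midpoint {y₁ = y₁} {y₂} {y₃} (y₁y₂ , y₂y₃) =
    trans (sym (relMap-rel y₁ y₂)) (cong (relMap U S i) y₁y₂) ,
    trans (sym (relMap-rel y₂ y₃)) (cong (relMap U S i) y₂y₃)

  relMap-* : ∀ u → relMap U S i (u U.*) ≡ (relMap U S i u) S.*
  -- Matching on the witness of u also unfolds  relMap U S i u  to  S.rel (i y) (i y').
  relMap-* u with U.witness u
  ... | (y , y') , refl = begin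
    relMap U S i (U.rel y y' U.*)   ≡⟨ cong (relMap U S i) (U.transpose y y') ⟨
    relMap U S i (U.rel y' y)       ≡⟨ relMap-rel y' y ⟩
    S.rel (i y') (i y)              ≡⟨ S.transpose (i y) (i y') ⟩
    S.rel (i y) (i y') S.*          ∎

module ClosedSubsetProperties {n m : ℕ} (S : Scheme n m)
  {T : Pred (Fin m) 0ℓ} (closed : Scheme.Closed S T) where
  open Scheme S
  open SchemeProperties S

  T⇒T-one : ∀ {t} → T t → T one
  T⇒T-one {t} Tt with witness t
  ... | (x , y) , e =
    subst T (rel-refl y) (closed t t (rel y y) Tt Tt (midpoint⇒∈· (rel-transpose e , e)))

  T-* : ∀ {t} → T t → T (t *)
  T-* {t} Tt with witness t
  ... | (x , y) , e = subst T (rel-transpose e)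
    (closed t one (rel y x) Tt (T⇒T-one Tt) (midpoint⇒∈· (rel-transpose e , rel-refl x)))

  T-sym : ∀ {x y} → T (rel x y) → T (rel y x)
  T-sym {x} {y} h = subst T (sym (transpose x y)) (T-* h)

  T-trans : ∀ {x y z} → T (rel x y) → T (rel y z) → T (rel x z)
  T-trans {x} {y} {z} h₁ h₂ =
    closed (rel y x) (rel y z) (rel x z) (T-sym h₁) h₂ (midpoint⇒∈· (transpose y x , refl))

  InCoset⇒T : ∀ {x w} → InCoset T x w → T (rel x w)
  InCoset⇒T (t , Tt , e) = subst T (sym e) Tt

  T⇒InCoset : ∀ {x w} → T (rel x w) → InCoset T x w
  T⇒InCoset h = _ , h , refl

  T⇒CosetEq : ∀ {x y} → T (rel x y) → CosetEq T x y
  T⇒CosetEq h w = mk⇔ (λ c → T⇒InCoset (T-trans (T-sym h) (InCoset⇒T c)))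
                      (λ c → T⇒InCoset (T-trans h (InCoset⇒T c)))

  CosetEq⇒T : T one → ∀ {x y} → CosetEq T x y → T (rel x y)
  CosetEq⇒T one∈T {y = y} c =
    InCoset⇒T (Equivalence.from (c y) (T⇒InCoset (subst T (sym (rel-refl y)) one∈T)))

  CosetEq-sym : ∀ {x y} → CosetEq T x y → CosetEq T y x
  CosetEq-sym c w = mk⇔ (Equivalence.from (c w)) (Equivalence.to (c w))

  CosetEq-trans : ∀ {x y z} → CosetEq T x y → CosetEq T y z → CosetEq T x z
  CosetEq-trans c₁ c₂ w = mk⇔ (Equivalence.to (c₂ w) ∘ Equivalence.to (c₁ w))
                              (Equivalence.from (c₁ w) ∘ Equivalence.from (c₂ w))

  InQuot-transport : ∀ {s s' x y x' y'} →
    InQuot T s x y → InQuot T s' x y → InQuot T s x' y' → InQuot T s' x' y'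
  InQuot-transport (x₁ , y₁ , x₁∈ , y₁∈ , e₁) (x₂ , y₂ , x₂∈ , y₂∈ , e₂) (x₁' , y₁' , x₁'∈ , y₁'∈ , e₁')
    with midpoint-transfer {y = x₂} (trans e₁ (sym e₁'))
  ... | x₂' , x₁'x₂' , x₂'y₁' with midpoint-transfer {y = y₂} (sym x₂'y₁')
  ... | y₂' , x₂'y₂' , y₂'y₁' = x₂' , y₂' , T⇒InCoset x'x₂' , T⇒InCoset y'y₂' , trans x₂'y₂' e₂
    where
    x'x₂' = T-trans (InCoset⇒T x₁'∈)
      (subst T (sym x₁'x₂') (T-trans (T-sym (InCoset⇒T x₁∈)) (InCoset⇒T x₂∈)))
    y'y₂' = T-trans (InCoset⇒T y₁'∈)
      (T-sym (subst T (sym y₂'y₁') (T-trans (T-sym (InCoset⇒T y₂∈)) (InCoset⇒T y₁∈))))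

  InQuot⇒QuotEq : ∀ {s s' x y} → InQuot T s x y → InQuot T s' x y → QuotEq T s s'
  InQuot⇒QuotEq h h' _ _ = mk⇔ (InQuot-transport h h') (InQuot-transport h' h)

module QuotientIsomorphism {nY mU nZ mS : ℕ} (U : BasedScheme nY mU) (S : BasedScheme nZ mS)
  {T : Pred (Fin mS) 0ℓ} (closed : BasedScheme.Closed S T)
  {i : Fin nY → Fin nZ} (i-mor : IsMorphism U S i) (iπ-iso : IsoToQuotient U S T i) where
  private
    module U = BasedScheme U
    module U′ = SchemeProperties U.scheme
  open BasedScheme S
  open SchemeProperties scheme
  open ClosedSubsetProperties scheme closed
  open MorphismProperties U S i-mor

  private
    iπ-injective  = proj₁ iπ-iso
    iπ-surjective = proj₁ (proj₂ iπ-iso)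
    iπ-injectiveᴿ = proj₁ (proj₂ (proj₂ iπ-iso))

  iπ⁻¹ : Fin nZ → Fin nY
  iπ⁻¹ z = proj₁ (iπ-surjective z)

  iπ⁻¹-spec : ∀ z → CosetEq T z (i (iπ⁻¹ z))
  iπ⁻¹-spec z = proj₂ (iπ-surjective z)

  iπ⁻¹-unique : ∀ {z y} → CosetEq T z (i y) → iπ⁻¹ z ≡ y
  iπ⁻¹-unique c = iπ-injective _ _ (CosetEq-trans (CosetEq-sym (iπ⁻¹-spec _)) c)

  iπ⁻¹∘i : ∀ y → iπ⁻¹ (i y) ≡ y
  iπ⁻¹∘i y = iπ-injective _ _ (CosetEq-sym (iπ⁻¹-spec (i y)))

  Thin : Set
  Thin = ∀ u t → T t → ∣ t · relMap U S i u ∣ ≡ 1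

  MidpointLifting : Set
  MidpointLifting = ∀ {p q r z₁ z₃ y₁ y₂ y₃} → rel z₁ z₃ ≡ relMap U S i r →
    iπ⁻¹ z₁ ≡ y₁ → iπ⁻¹ z₃ ≡ y₃ → U′.Midpoint p q y₁ y₃ y₂ →
    ∃ λ z₂ → Midpoint (relMap U S i p) (relMap U S i q) z₁ z₃ z₂ × iπ⁻¹ z₂ ≡ y₂

  module Degenerate (one∉T : ¬ T one) where
    private
      T-empty : ∀ {t} → ¬ T t
      T-empty = one∉T ∘ T⇒T-one

      CosetEq-trivial : ∀ x y → CosetEq T x y
      CosetEq-trivial x y w =
        mk⇔ (λ (_ , Tt , _) → ⊥-elim (T-empty Tt)) (λ (_ , Tt , _) → ⊥-elim (T-empty Tt))

    points-equal : ∀ y y' → y ≡ y'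
    points-equal y y' = iπ-injective y y' (CosetEq-trivial (i y) (i y'))

    relations-equal : ∀ u u' → u ≡ u'
    relations-equal u u' = iπ-injectiveᴿ u u' λ _ _ →
      mk⇔ (λ (_ , _ , (_ , Tt , _) , _) → ⊥-elim (T-empty Tt))
          (λ (_ , _ , (_ , Tt , _) , _) → ⊥-elim (T-empty Tt))

    lift-midpoint : MidpointLifting
    lift-midpoint {r = r} {z₁} {z₃} {y₁} {y₂} {y₃} r-z₁z₃ _ _ y₂-mid
      with midpoint-transfer {y = i y₂} (begin
        rel (i y₁) (i y₃)            ≡⟨ relMap-rel y₁ y₃ ⟨
        relMap U S i (U.rel y₁ y₃)   ≡⟨ cong (relMap U S i) (relations-equal _ r) ⟩
        relMap U S i r               ≡⟨ r-z₁z₃ ⟨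
        rel z₁ z₃                    ∎)
    ... | z₂ , z₁z₂ , z₂z₃ =
      z₂ , (trans z₁z₂ (proj₁ i-mid) , trans z₂z₃ (proj₂ i-mid)) , points-equal _ _
      where i-mid = relMap-midpoint y₂-mid

  module Nondegenerate (one∈T : T one) where
    T⇒iπ⁻¹-≡ : ∀ {w w'} → T (rel w w') → iπ⁻¹ w ≡ iπ⁻¹ w'
    T⇒iπ⁻¹-≡ h = iπ⁻¹-unique (CosetEq-trans (T⇒CosetEq h) (iπ⁻¹-spec _))

    iπ⁻¹-≡⇒T : ∀ {w w'} → iπ⁻¹ w ≡ iπ⁻¹ w' → T (rel w w')
    iπ⁻¹-≡⇒T {w} {w'} e = CosetEq⇒T one∈T (CosetEq-trans (iπ⁻¹-spec w)
      (subst (λ y → CosetEq T (i y) w') (sym e) (CosetEq-sym (iπ⁻¹-spec w'))))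

    T? : Decidable T
    T? t with witness t
    ... | (x , y) , e =
      map′ (subst T e ∘ iπ⁻¹-≡⇒T) (T⇒iπ⁻¹-≡ ∘ subst T (sym e)) (iπ⁻¹ x ≟ iπ⁻¹ y)

    self-InCoset : ∀ w → InCoset T w w
    self-InCoset w = T⇒InCoset (subst T (sym (rel-refl w)) one∈T)

    rel-iπ⁻¹ : ∀ {w w' u} → rel w w' ≡ relMap U S i u → U.rel (iπ⁻¹ w) (iπ⁻¹ w') ≡ u
    rel-iπ⁻¹ {w} {w'} e = sym (iπ-injectiveᴿ _ _ (InQuot⇒QuotEq
      (w , w' , self-InCoset w , self-InCoset w' , e)
      (i (iπ⁻¹ w) , i (iπ⁻¹ w')
        , Equivalence.from (iπ⁻¹-spec w _) (self-InCoset _)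
        , Equivalence.from (iπ⁻¹-spec w' _) (self-InCoset _)
        , sym (relMap-rel _ _))))

    iπ⁻¹-midpoint : ∀ {p q e₁ e₃ w} → Midpoint (relMap U S i p) (relMap U S i q) e₁ e₃ w →
      U′.Midpoint p q (iπ⁻¹ e₁) (iπ⁻¹ e₃) (iπ⁻¹ w)
    iπ⁻¹-midpoint (e₁w , we₃) = rel-iπ⁻¹ e₁w , rel-iπ⁻¹ we₃

    module Fibres (thin : Thin) (p q : Fin mU) where
      private
        s₁ = relMap U S i p
        s₃ = relMap U S i q

      Admissible : Pred (Fin mS) 0ℓ
      Admissible t = T t × (s₁ *) ∈ (t *) · (s₁ *) × s₃ ∈ (t *) · s₃

      admissible? : Decidable Admissible
      admissible? t = T? t ×-dec (0 <? a (t *) (s₁ *) (s₁ *)) ×-dec (0 <? a (t *) s₃ s₃)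

      fibre? : ∀ e₁ e₃ y → Decidable (λ w → Midpoint s₁ s₃ e₁ e₃ w × iπ⁻¹ w ≡ y)
      fibre? e₁ e₃ y w = midpoint? s₁ s₃ e₁ e₃ w ×-dec (iπ⁻¹ w ≟ y)

      -- Thinness makes t * s₁* and t * s₃ singletons, which pins down w e₁ and w e₃.
      fibre≐admissible : ∀ {e₁ e₃ w₀} → Midpoint s₁ s₃ e₁ e₃ w₀ →
        (λ w → Midpoint s₁ s₃ e₁ e₃ w × iπ⁻¹ w ≡ iπ⁻¹ w₀) ≐ (Admissible ∘ rel w₀)
      fibre≐admissible {e₁} {e₃} {w₀} (e₁w₀ , w₀e₃) = to , from
        where
        to : ∀ {w} → Midpoint s₁ s₃ e₁ e₃ w × iπ⁻¹ w ≡ iπ⁻¹ w₀ → Admissible (rel w₀ w)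
        to {w} ((e₁w , we₃) , w↦w₀) =
            iπ⁻¹-≡⇒T (sym w↦w₀)
          , subst (_∈ (rel w₀ w *) · (s₁ *)) (rel-transpose e₁w)
              (midpoint⇒∈· (transpose w₀ w , rel-transpose e₁w₀))
          , subst (_∈ (rel w₀ w *) · s₃) we₃ (midpoint⇒∈· (transpose w₀ w , w₀e₃))
        from : ∀ {w} → Admissible (rel w₀ w) → Midpoint s₁ s₃ e₁ e₃ w × iπ⁻¹ w ≡ iπ⁻¹ w₀
        from {w} (Tt , h₁ , h₃) = (e₁w , we₃) , sym (T⇒iπ⁻¹-≡ Tt)
          where
          t = rel w₀ w
          thin₁ : ∣ (t *) · (s₁ *) ∣ ≡ 1
          thin₁ = subst (λ s → ∣ (t *) · s ∣ ≡ 1) (relMap-* p) (thin (p U.*) (t *) (T-* Tt))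
          e₁w : rel e₁ w ≡ s₁
          e₁w = trans (rel-transpose
                  (∈·-unique thin₁ (midpoint⇒∈· (transpose w₀ w , rel-transpose e₁w₀)) h₁))
                (*-involutive s₁)
          we₃ : rel w e₃ ≡ s₃
          we₃ = ∈·-unique (thin q (t *) (T-* Tt)) (midpoint⇒∈· (transpose w₀ w , w₀e₃)) h₃

      nonempty-fibres-equal : ∀ {e₁ e₃ e₁' e₃' w w' y} →
        Midpoint s₁ s₃ e₁ e₃ w → Midpoint s₁ s₃ e₁' e₃' w' → iπ⁻¹ w ≡ y → iπ⁻¹ w' ≡ y →
        count (fibre? e₁ e₃ y) ≡ count (fibre? e₁' e₃' y)
      nonempty-fibres-equal {e₁} {e₃} {e₁'} {e₃'} {w} {w'} m m' refl w'↦y = begin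
        count (fibre? e₁ e₃ (iπ⁻¹ w))      ≡⟨ count-≐ _ _ (fibre≐admissible m) ⟩
        count (admissible? ∘ rel w)        ≡⟨ count-rel-invariant admissible? w w' ⟩
        count (admissible? ∘ rel w')       ≡⟨ count-≐ _ _ (fibre≐admissible m') ⟨
        count (fibre? e₁' e₃' (iπ⁻¹ w'))   ≡⟨ cong (count ∘ fibre? e₁' e₃') w'↦y ⟩
        count (fibre? e₁' e₃' (iπ⁻¹ w))    ∎

    lift-midpoint : Thin → MidpointLifting
    lift-midpoint thin {p} {q} {r} {z₁} {z₃} {y₂ = y₂} r-z₁z₃ refl refl y₂-mid =
      length-filter>0⇒∃ (fibre? z₁ z₃ y₂) (allFin nZ) (subst (0 <_) (sym (fibres-equal y₂))
        (filter-some (fibre? x₁ x₃ y₂) (lose (∈-allFin (i y₂)) (relMap-midpoint y₂-mid , iπ⁻¹∘i y₂))))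
      where
      open Fibres thin p q
      x₁ = i (iπ⁻¹ z₁)
      x₃ = i (iπ⁻¹ z₃)

      z-fibre x-fibre : Fin nY → ℕ
      z-fibre y = count (fibre? z₁ z₃ y)
      x-fibre y = count (fibre? x₁ x₃ y)

      equal-totals : sum z-fibre ≡ sum x-fibre
      equal-totals = begin
        sum z-fibre                      ≡⟨ length-filter-fibres _ iπ⁻¹ (allFin nZ) ⟨
        count (midpoint? _ _ z₁ z₃)      ≡⟨ #midpoints-regular _ _ same-rel ⟩
        count (midpoint? _ _ x₁ x₃)      ≡⟨ length-filter-fibres _ iπ⁻¹ (allFin nZ) ⟩
        sum x-fibre                      ∎
        where
        same-rel : rel z₁ z₃ ≡ rel x₁ x₃
        same-rel = trans r-z₁z₃ (trans (cong (relMap U S i) (sym (rel-iπ⁻¹ r-z₁z₃))) (relMap-rel _ _))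

      z-fibre≤x-fibre : ∀ y → z-fibre y ≤ x-fibre y
      z-fibre≤x-fibre y with z-fibre y in eq
      ... | zero  = z≤n
      ... | suc _ with length-filter>0⇒∃ (fibre? z₁ z₃ y) (allFin nZ) (subst (0 <_) (sym eq) (s≤s z≤n))
      ... | w , w-mid , w↦y = ≤-reflexive (trans (sym eq) (nonempty-fibres-equal
              w-mid (relMap-midpoint (iπ⁻¹-midpoint w-mid)) w↦y (trans (iπ⁻¹∘i _) w↦y)))

      fibres-equal : ∀ y → z-fibre y ≡ x-fibre y
      fibres-equal = ∑-≤-≡⇒≗ z-fibre≤x-fibre equal-totals

  -- Whether T is empty is undecidable, but the sought z₂ is a decidable search over Fin nZ,
  -- so a double-negated case split on  T one  suffices.
  lift-midpoint : Thin → MidpointLifting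
  lift-midpoint thin {z₁ = z₁} {z₃} {y₂ = y₂} r-z₁z₃ z₁↦y₁ z₃↦y₃ y₂-mid =
    decidable-stable (any? (λ z → midpoint? _ _ z₁ z₃ z ×-dec (iπ⁻¹ z ≟ y₂))) λ none →
      ¬¬-excluded-middle λ where
        (yes one∈T) → none (Nondegenerate.lift-midpoint one∈T thin r-z₁z₃ z₁↦y₁ z₃↦y₃ y₂-mid)
        (no one∉T)  → none (Degenerate.lift-midpoint one∉T r-z₁z₃ z₁↦y₁ z₃↦y₃ y₂-mid)

lemma7p18 : {nY mU nZ mS : ℕ} (U : BasedScheme nY mU) (S : BasedScheme nZ mS)
    (T : Pred (Fin mS) 0ℓ) → BasedScheme.Closed S T →
    (i : Fin nY → Fin nZ) → IsBasedMorphism U S i → IsoToQuotient U S T i →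
    (∀ u t → T t → BasedScheme.∣_·_∣ S t (relMap U S i u) ≡ 1) →
    (p q r : Fin mU) → BasedScheme._∈_·_ U r p q →
    (z₁ z₃ : Fin nZ) → BasedScheme._∈_⟨_⟩ S z₃ z₁ (relMap U S i r) →
    (y₁ y₃ : Fin nY) → BasedScheme.CosetEq S T z₁ (i y₁) → BasedScheme.CosetEq S T z₃ (i y₃) →
    (y₂ : Fin nY) → BasedScheme._∈_⟨_⟩ U y₂ y₁ p →
    BasedScheme._∈_⟨_⟩ U y₂ y₃ (BasedScheme._* U q) →
    ∃ λ z₂ → BasedScheme._∈_⟨_⟩ S z₂ z₁ (relMap U S i p)
    × BasedScheme._∈_⟨_⟩ S z₂ z₃ (BasedScheme._* S (relMap U S i q))
    × BasedScheme.CosetEq S T z₂ (i y₂)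
lemma7p18 U S T closed i (i-mor , _) iπ-iso thin p q r _ z₁ z₃ r-z₁z₃ y₁ y₃ z₁∼y₁ z₃∼y₃
          y₂ p-y₁y₂ q*-y₃y₂ =
  let z₂ , (z₁z₂ , z₂z₃) , z₂↦y₂ =
        lift-midpoint thin r-z₁z₃ (iπ⁻¹-unique z₁∼y₁) (iπ⁻¹-unique z₃∼y₃) (p-y₁y₂ , q-y₂y₃)
  in z₂ , z₁z₂ , S′.rel-transpose z₂z₃ , subst (CosetEq T z₂ ∘ i) z₂↦y₂ (iπ⁻¹-spec z₂)
  where
  open QuotientIsomorphism U S closed i-mor iπ-iso
  open BasedScheme S using (CosetEq)
  module U′ = SchemeProperties (BasedScheme.scheme U)
  module S′ = SchemeProperties (BasedScheme.scheme S)
  q-y₂y₃ = trans (U′.rel-transpose q*-y₃y₂) (U′.*-involutive q)
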